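{- Let $p$ be a prime, let $r=p-1$, and let $g\in\mathbb{F}_p[x_1,\ldots,x_n]$ be a homogeneous polynomial of degree $k$. Then $\deg_p(g)=k$ if and only if $g$ contains an $r$-monomial.
   Context: For $g\in\mathbb{F}_p[x_1,\ldots,x_n]$, $\deg_p(g)$ is the total degree of the polynomial obtained from $g$ by reducing modulo $x_1^p-x_1,\ldots,x_n^p-x_n$ (replacing each $x_i^t$ by $x_i^t\bmod (x_i^p-x_i)$). A monomial $x_1^{a_1}\cdots x_n^{a_n}$ is an $r$-monomial if $a_j\le r$ for all $j$; $g$ contains an $r$-monomial if some $r$-monomial appears in $g$ with nonzero coefficient. -}

module Defs where

open import Data.Nat using (ℕ; zero; suc; _+_; _∸_; _≤_; _≟_)
open import Data.Nat.DivMod using (_%_)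
open import Data.Nat.Divisibility using (_∣_)
open import Data.Product using (_×_; _,_; ∃-syntax)
open import Data.List using (List; []; _∷_; map)
open import Data.Vec as Vec using (Vec)
open import Data.Vec.Properties using (≡-dec)
open import Data.Vec.Relation.Unary.All using (All)
open import Relation.Nullary using (¬_; yes; no)

-- A polynomial in F_p[x_1,...,x_n] is represented as a finite formal sum
-- (list) of terms  c * x^e  with c : ℕ (read modulo p) and e : Vec ℕ n
-- the exponent vector.
Term : ℕ → Set
Term n = ℕ × Vec ℕ n

Poly : ℕ → Set
Poly n = List (Term n)

coeff : ∀ {n} → Vec ℕ n → Poly n → ℕ
coeff e [] = 0
coeff e ((c , e') ∷ g) with ≡-dec _≟_ e' e
... | yes _ = c + coeff e g
... | no  _ = coeff e g

Appears : ∀ {n} → ℕ → Poly n → Vec ℕ n → Set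
Appears p g e = ¬ (p ∣ coeff e g)

totalDeg : ∀ {n} → Vec ℕ n → ℕ
totalDeg = Vec.sum

Homogeneous : ∀ {n} → ℕ → ℕ → Poly n → Set
Homogeneous p k g = ∀ e → Appears p g e → totalDeg e ≡ k
  where open import Relation.Binary.PropositionalEquality using (_≡_)

-- t mod m, with m = 0 left unreduced (only used for m = p - 1 ≥ 1).
modGen : ℕ → ℕ → ℕ
modGen zero    t = t
modGen (suc m) t = t % suc m

-- Exponent of x^t mod (x^p - x): 0 ↦ 0, t ≥ 1 ↦ 1 + ((t - 1) mod (p - 1)).
redExp : ℕ → ℕ → ℕ
redExp p zero    = zero
redExp p (suc t) = suc (modGen (p ∸ 1) t)

reduce : ∀ {n} → ℕ → Poly n → Poly n
reduce p = map (λ { (c , e) → (c , Vec.map (redExp p) e) })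

DegPEq : ∀ {n} → ℕ → Poly n → ℕ → Set
DegPEq p g k =
  (∃[ e ] (Appears p (reduce p g) e × totalDeg e ≡ k)) ×
  (∀ e → Appears p (reduce p g) e → totalDeg e ≤ k)
  where open import Relation.Binary.PropositionalEquality using (_≡_)

IsRMonomial : ∀ {n} → ℕ → Vec ℕ n → Set
IsRMonomial r e = All (λ a → a ≤ r) e

ContainsRMonomial : ∀ {n} → ℕ → ℕ → Poly n → Set
ContainsRMonomial p r g = ∃[ e ] (Appears p g e × IsRMonomial r e)

-- Reducing modulo x_i^p - x_i replaces every exponent by one that is no larger and
-- fixes exactly the exponents ≤ p - 1, so the reduction of x^e keeps the degree of
-- x^e iff x^e is an r-monomial.  Every monomial of the reduction of g is the image of a
-- monomial of g, which gives deg_p(g) ≤ k and, when deg_p(g) = k, an r-monomial of g.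
-- Conversely, for an r-monomial x^e of the homogeneous g, any monomial of g reducing to
-- x^e keeps its degree, hence is fixed, hence is x^e itself: nothing cancels it.
module Submission where

open import Defs
open import Data.Nat using (ℕ; zero; suc; _+_; _∸_; _≤_; _<_; _≟_; z≤n; s≤s)
open import Data.Nat.Properties
  using (≤-refl; ≤-antisym; m≤n⇒m≤1+n; +-mono-≤; +-monoʳ-≤; +-cancelʳ-≤; +-cancelˡ-≡; +-comm; +-assoc; +-commutativeSemigroup; suc-injective)
open import Algebra.Properties.CommutativeSemigroup +-commutativeSemigroup using (x∙yz≈y∙xz)
open import Data.Nat.DivMod using (m%n≤m; m%n<n; m≤n⇒m%n≡m)
open import Data.Nat.Divisibility using (_∣_; _∣?_; _∣0; ∣m∣n⇒∣m+n; ∣m+n∣m⇒∣n)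
open import Data.Nat.Induction using (<-wellFounded)
open import Data.Nat.Primality using (Prime)
open import Data.Product using (_×_; _,_; proj₂; ∃-syntax)
open import Data.List using ([]; _∷_; map; length)
open import Data.Vec as Vec using (Vec; []; _∷_)
open import Data.Vec.Properties using (≡-dec)
open import Data.Vec.Relation.Unary.All as All using (All; []; _∷_)
open import Function using (_on_)
open import Induction.WellFounded using (Acc; acc)
open import Relation.Binary.Construct.On as On using ()
open import Relation.Binary.PropositionalEquality
open import Relation.Nullary using (¬_; yes; no; contradiction; ¬?; _×-dec_)

module ExponentMap {n : ℕ} (f : Vec ℕ n → Vec ℕ n) where

  mapExponents : Poly n → Poly n
  mapExponents = map (λ (c , e) → c , f e)

  removeExponent : Vec ℕ n → Poly n → Poly n
  removeExponent e₀ [] = []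
  removeExponent e₀ ((c , e) ∷ g) with ≡-dec _≟_ e e₀
  ... | yes _ = removeExponent e₀ g
  ... | no  _ = (c , e) ∷ removeExponent e₀ g

  length-removeExponent : ∀ e₀ g → length (removeExponent e₀ g) ≤ length g
  length-removeExponent e₀ [] = z≤n
  length-removeExponent e₀ ((c , e) ∷ g) with ≡-dec _≟_ e e₀
  ... | yes _ = m≤n⇒m≤1+n (length-removeExponent e₀ g)
  ... | no  _ = s≤s (length-removeExponent e₀ g)

  length-removeExponent-head : ∀ c e₀ g →
    length (removeExponent e₀ ((c , e₀) ∷ g)) < length ((c , e₀) ∷ g)
  length-removeExponent-head c e₀ g with ≡-dec _≟_ e₀ e₀
  ... | yes _    = s≤s (length-removeExponent e₀ g)
  ... | no e₀≢e₀ = contradiction refl e₀≢e₀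

  coeff-removeExponent-≢ : ∀ {e e₀} g → e ≢ e₀ → coeff e (removeExponent e₀ g) ≡ coeff e g
  coeff-removeExponent-≢ [] e≢e₀ = refl
  coeff-removeExponent-≢ {e} {e₀} ((c , e′) ∷ g) e≢e₀ with ≡-dec _≟_ e′ e₀
  ... | yes refl with ≡-dec _≟_ e′ e
  ...   | yes refl = contradiction refl e≢e₀
  ...   | no  _    = coeff-removeExponent-≢ g e≢e₀
  coeff-removeExponent-≢ {e} {e₀} ((c , e′) ∷ g) e≢e₀ | no _ with ≡-dec _≟_ e′ e
  ...   | yes _ = cong (c +_) (coeff-removeExponent-≢ g e≢e₀)
  ...   | no  _ = coeff-removeExponent-≢ g e≢e₀

  coeff-removeExponent-≡ : ∀ e₀ g → coeff e₀ (removeExponent e₀ g) ≡ 0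
  coeff-removeExponent-≡ e₀ [] = refl
  coeff-removeExponent-≡ e₀ ((c , e) ∷ g) with ≡-dec _≟_ e e₀
  ... | yes _ = coeff-removeExponent-≡ e₀ g
  ... | no e≢e₀ with ≡-dec _≟_ e e₀
  ...   | yes e≡e₀ = contradiction e≡e₀ e≢e₀
  ...   | no  _    = coeff-removeExponent-≡ e₀ g

  coeff-mapExponents-≡ : ∀ {e₀ e′} g → f e₀ ≡ e′ →
    coeff e′ (mapExponents g) ≡ coeff e₀ g + coeff e′ (mapExponents (removeExponent e₀ g))
  coeff-mapExponents-≡ [] _ = refl
  coeff-mapExponents-≡ {e₀} {e′} ((c , e) ∷ g) fe₀≡e′ with ≡-dec _≟_ e e₀
  ... | yes refl with ≡-dec _≟_ (f e) e′
  ...   | yes _ = trans (cong (c +_) (coeff-mapExponents-≡ g fe₀≡e′)) (sym (+-assoc c _ _))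
  ...   | no fe≢e′ = contradiction fe₀≡e′ fe≢e′
  coeff-mapExponents-≡ {e₀} {e′} ((c , e) ∷ g) fe₀≡e′ | no _ with ≡-dec _≟_ (f e) e′
  ...   | yes _ = trans (cong (c +_) (coeff-mapExponents-≡ g fe₀≡e′))
                    (x∙yz≈y∙xz c (coeff e₀ g) (coeff e′ (mapExponents (removeExponent e₀ g))))
  ...   | no  _ = coeff-mapExponents-≡ g fe₀≡e′

  coeff-mapExponents-≢ : ∀ {e₀ e′} g → f e₀ ≢ e′ →
    coeff e′ (mapExponents g) ≡ coeff e′ (mapExponents (removeExponent e₀ g))
  coeff-mapExponents-≢ [] _ = refl
  coeff-mapExponents-≢ {e₀} {e′} ((c , e) ∷ g) fe₀≢e′ with ≡-dec _≟_ e e₀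
  ... | yes refl with ≡-dec _≟_ (f e) e′
  ...   | yes fe≡e′ = contradiction fe≡e′ fe₀≢e′
  ...   | no  _     = coeff-mapExponents-≢ g fe₀≢e′
  coeff-mapExponents-≢ {e₀} {e′} ((c , e) ∷ g) fe₀≢e′ | no _ with ≡-dec _≟_ (f e) e′
  ...   | yes _ = cong (c +_) (coeff-mapExponents-≢ g fe₀≢e′)
  ...   | no  _ = coeff-mapExponents-≢ g fe₀≢e′

  module _ (p : ℕ) where

    appears-removeExponent : ∀ {e e₀} g → Appears p (removeExponent e₀ g) e → e ≢ e₀ × Appears p g e
    appears-removeExponent {e} {e₀} g app with ≡-dec _≟_ e e₀
    ... | yes refl = contradiction (subst (p ∣_) (sym (coeff-removeExponent-≡ e₀ g)) (p ∣0)) app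
    ... | no e≢e₀  = e≢e₀ , subst (λ x → ¬ p ∣ x) (coeff-removeExponent-≢ g e≢e₀) app

    remainder-appears : ∀ {e₀ e′} g → Appears p (mapExponents g) e′ → ¬ (f e₀ ≡ e′ × Appears p g e₀) →
      Appears p (mapExponents (removeExponent e₀ g)) e′
    remainder-appears {e₀} {e′} g app ¬contrib p∣rest with ≡-dec _≟_ (f e₀) e′
    ... | no fe₀≢e′ = app (subst (p ∣_) (sym (coeff-mapExponents-≢ g fe₀≢e′)) p∣rest)
    ... | yes fe₀≡e′ with p ∣? coeff e₀ g
    ...   | yes p∣ = app (subst (p ∣_) (sym (coeff-mapExponents-≡ g fe₀≡e′)) (∣m∣n⇒∣m+n p∣ p∣rest))
    ...   | no ¬p∣ = ¬contrib (fe₀≡e′ , ¬p∣)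

    -- Either the head exponent e₀ contributes to e′ with a unit coefficient, or deleting
    -- all terms with exponent e₀ leaves e′ appearing in a strictly shorter polynomial.
    appears-preimage-acc : ∀ {e′} g → Acc (_<_ on length) g → Appears p (mapExponents g) e′ →
      ∃[ e ] (f e ≡ e′ × Appears p g e)
    appears-preimage-acc [] _ app = contradiction (p ∣0) app
    appears-preimage-acc {e′} g@((c , e₀) ∷ g′) (acc rs) app
      with ≡-dec _≟_ (f e₀) e′ ×-dec ¬? (p ∣? coeff e₀ g)
    ... | yes (fe₀≡e′ , app₀) = e₀ , fe₀≡e′ , app₀
    ... | no ¬contrib
      with appears-preimage-acc (removeExponent e₀ g) (rs (length-removeExponent-head c e₀ g′))
             (remainder-appears g app ¬contrib)
    ...   | e , fe≡e′ , app-e = e , fe≡e′ , proj₂ (appears-removeExponent g app-e)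

    appears-preimage : ∀ {e′} g → Appears p (mapExponents g) e′ → ∃[ e ] (f e ≡ e′ × Appears p g e)
    appears-preimage g = appears-preimage-acc g (On.wellFounded length <-wellFounded g)

    appears-image : ∀ {e₁ e′} g → f e₁ ≡ e′ → Appears p g e₁ →
      (∀ e → f e ≡ e′ → Appears p g e → e ≡ e₁) → Appears p (mapExponents g) e′
    appears-image {e₁} {e′} g fe₁≡e′ app₁ unique p∣image
      with p ∣? coeff e′ (mapExponents (removeExponent e₁ g))
    ... | yes p∣rest = app₁ (∣m+n∣m⇒∣n p∣rest+coeff p∣rest)
      where
        p∣rest+coeff : p ∣ coeff e′ (mapExponents (removeExponent e₁ g)) + coeff e₁ g
        p∣rest+coeff = subst (p ∣_) (trans (coeff-mapExponents-≡ g fe₁≡e′) (+-comm (coeff e₁ g) _)) p∣image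
    ... | no ¬p∣rest with appears-preimage (removeExponent e₁ g) ¬p∣rest
    ...   | e , fe≡e′ , app-e with appears-removeExponent g app-e
    ...     | e≢e₁ , app-e′ = e≢e₁ (unique e fe≡e′ app-e′)

module _ {h : ℕ → ℕ} (h-≤ : ∀ t → h t ≤ t) where

  sum-map-≤ : ∀ {m} (e : Vec ℕ m) → Vec.sum (Vec.map h e) ≤ Vec.sum e
  sum-map-≤ []      = z≤n
  sum-map-≤ (t ∷ e) = +-mono-≤ (h-≤ t) (sum-map-≤ e)

  sum-map-≡⇒fixed : ∀ {m} (e : Vec ℕ m) → Vec.sum (Vec.map h e) ≡ Vec.sum e → All (λ t → h t ≡ t) e
  sum-map-≡⇒fixed []      _  = []
  sum-map-≡⇒fixed (t ∷ e) eq =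
    ht≡t ∷ sum-map-≡⇒fixed e (+-cancelˡ-≡ t _ _ (trans (cong (_+ _) (sym ht≡t)) eq))
    where
      t≤ht : t ≤ h t
      t≤ht = +-cancelʳ-≤ (Vec.sum e) t (h t)
               (subst (_≤ h t + Vec.sum e) eq (+-monoʳ-≤ (h t) (sum-map-≤ e)))
      ht≡t : h t ≡ t
      ht≡t = ≤-antisym (h-≤ t) t≤ht

map-fixed : ∀ {h : ℕ → ℕ} {m} {e : Vec ℕ m} → All (λ t → h t ≡ t) e → Vec.map h e ≡ e
map-fixed []           = refl
map-fixed (ht≡t ∷ hes) = cong₂ Vec._∷_ ht≡t (map-fixed hes)

modGen-≤ : ∀ m t → modGen m t ≤ t
modGen-≤ zero    t = ≤-refl
modGen-≤ (suc m) t = m%n≤m t (suc m)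

redExp-≤ : ∀ p t → redExp p t ≤ t
redExp-≤ p zero    = z≤n
redExp-≤ p (suc t) = s≤s (modGen-≤ (p ∸ 1) t)

module _ (q : ℕ) where

  private
    r p : ℕ
    r = suc q
    p = suc r

  redExp-≡⇒≤ : ∀ {t} → redExp p t ≡ t → t ≤ r
  redExp-≡⇒≤ {zero}  _  = z≤n
  redExp-≡⇒≤ {suc t} eq = subst (λ x → suc x ≤ r) (suc-injective eq) (m%n<n t r)

  ≤⇒redExp-≡ : ∀ {t} → t ≤ r → redExp p t ≡ t
  ≤⇒redExp-≡ {zero}  _         = refl
  ≤⇒redExp-≡ {suc t} (s≤s t≤q) = cong suc (m≤n⇒m%n≡m t≤q)

  module _ {n k : ℕ} (g : Poly n) (hom : Homogeneous p k g) where

    open ExponentMap {n} (Vec.map (redExp p))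

    degPEq⇒containsRMonomial : DegPEq p g k → ContainsRMonomial p r g
    degPEq⇒containsRMonomial ((e′ , app′ , deg′) , _) with appears-preimage p g app′
    ... | e , refl , app =
      e , app , All.map redExp-≡⇒≤ (sum-map-≡⇒fixed (redExp-≤ p) e (trans deg′ (sym (hom e app))))

    containsRMonomial⇒degPEq : ContainsRMonomial p r g → DegPEq p g k
    containsRMonomial⇒degPEq (e₁ , app₁ , rmon₁) =
      (e₁ , appears-image p g fixed₁ app₁ unique , hom e₁ app₁) , bounded
      where
        fixed₁ : Vec.map (redExp p) e₁ ≡ e₁
        fixed₁ = map-fixed (All.map ≤⇒redExp-≡ rmon₁)

        unique : ∀ e → Vec.map (redExp p) e ≡ e₁ → Appears p g e → e ≡ e₁
        unique e fe≡e₁ app = trans (sym fixed) fe≡e₁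
          where
            fixed : Vec.map (redExp p) e ≡ e
            fixed = map-fixed (sum-map-≡⇒fixed (redExp-≤ p) e
                      (trans (cong Vec.sum fe≡e₁) (trans (hom e₁ app₁) (sym (hom e app)))))

        bounded : ∀ e′ → Appears p (reduce p g) e′ → totalDeg e′ ≤ k
        bounded e′ app′ with appears-preimage p g app′
        ... | e , refl , app =
          subst (totalDeg (Vec.map (redExp p) e) ≤_) (hom e app) (sum-map-≤ (redExp-≤ p) e)

lemma7 : (p : ℕ) → Prime p → (n k : ℕ) → (g : Poly n) →
    Homogeneous p k g →
    (DegPEq p g k → ContainsRMonomial p (p ∸ 1) g) ×
    (ContainsRMonomial p (p ∸ 1) g → DegPEq p g k)
lemma7 0             ()
lemma7 1             ()
lemma7 (suc (suc q)) _  n k g hom = degPEq⇒containsRMonomial q g hom , containsRMonomial⇒degPEq q g hom
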